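{- For $k\ge 0$ let $a_0=0$ and $a_k=\sum_{i=0}^{k}4^i$ for $k>0$. Let $k\ge 1$, let $n\in\{a_{k-1}+1,\dots,a_k\}$, and let $\mathcal{T}$ be the almost perfect binary tree with $n$ leaves, whose leaves are labelled by $1,\dots,n$ according to an arbitrary permutation. Then there exists $j\in\{1,\dots,n\}$ such that $\mathrm{minmono}|\mathcal{T},[j]|\ge k$, where $[j]=\{1,\dots,j\}$.
   Context: An almost perfect binary tree is a rooted binary tree that differs from a perfect binary tree only by missing the last leaves of the last row, i.e. all levels except the deepest are full, every non-leaf vertex has exactly two children, and the vertices of the deepest level are the leftmost ones. It is regarded as an unrooted tree (the root is removed and its two incident edges merged into one edge). A monochromatic cut for $(\mathcal{T},\mathcal{A})$, $\mathcal{A}$ a set of leaves, is a set of edges whose removal yields a forest in which every tree has all its leaves in $\mathcal{A}$ or all its leaves outside $\mathcal{A}$; $\mathrm{minmono}|\mathcal{T},\mathcal{A}|$ is the minimal size of such a cut. -}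

module Defs where

open import Data.Nat using (ℕ; zero; suc; _+_; _^_; _<_; _≤_; _⊔_)
open import Data.Empty using (⊥)
open import Data.Unit using (⊤; tt)
open import Data.Sum using (_⊎_; inj₁; inj₂)
open import Data.Product using (Σ; _×_; _,_)
open import Data.List using (List; []; _∷_; length)
open import Data.List.Membership.Propositional using (_∈_)
open import Data.List.Relation.Unary.Unique.Propositional using (Unique)
open import Relation.Nullary using (¬_)
open import Relation.Binary.PropositionalEquality using (_≡_)
open import Relation.Binary.Construct.Closure.ReflexiveTransitive using (Star)

geom4 : ℕ → ℕ
geom4 zero    = 1
geom4 (suc m) = geom4 m + 4 ^ suc m

a : ℕ → ℕ
a zero    = 0
a (suc k) = geom4 (suc k)

data Tree : Set where
  leaf : Tree
  node : Tree → Tree → Tree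

data Vtx : Tree → Set where
  root : ∀ {t} → Vtx t
  inl  : ∀ {s u} → Vtx s → Vtx (node s u)
  inr  : ∀ {s u} → Vtx u → Vtx (node s u)

data Leaf : Tree → Set where
  here : Leaf leaf
  inl  : ∀ {s u} → Leaf s → Leaf (node s u)
  inr  : ∀ {s u} → Leaf u → Leaf (node s u)

leafVtx : ∀ {t} → Leaf t → Vtx t
leafVtx here    = root
leafVtx (inl x) = inl (leafVtx x)
leafVtx (inr x) = inr (leafVtx x)

data Edge : Tree → Set where
  down-l : ∀ {s u} → Edge (node s u)
  down-r : ∀ {s u} → Edge (node s u)
  el     : ∀ {s u} → Edge s → Edge (node s u)
  er     : ∀ {s u} → Edge u → Edge (node s u)

top : ∀ {t} → Edge t → Vtx t
top down-l = root
top down-r = root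
top (el e) = inl (top e)
top (er e) = inr (top e)

bot : ∀ {t} → Edge t → Vtx t
bot down-l = inl root
bot down-r = inr root
bot (el e) = inl (bot e)
bot (er e) = inr (bot e)

-- Almost perfect binary trees (levels given by paths of directions;
-- "left" = L < R = "right").

data Dir : Set where
  L R : Dir

data At : List Dir → Tree → Set where
  at-root : ∀ {t} → At [] t
  at-L    : ∀ {p s u} → At p s → At (L ∷ p) (node s u)
  at-R    : ∀ {p s u} → At p u → At (R ∷ p) (node s u)

-- q is strictly to the left of p (used for paths of equal length)
data LeftOf : List Dir → List Dir → Set where
  lr    : ∀ {p q} → LeftOf (L ∷ p) (R ∷ q)
  there : ∀ {d p q} → LeftOf p q → LeftOf (d ∷ p) (d ∷ q)

height : Tree → ℕ
height leaf       = 0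
height (node s u) = suc (height s ⊔ height u)

IsAlmostPerfect : Tree → Set
IsAlmostPerfect t =
  (∀ p → length p < height t → At p t) ×
  (∀ p q → length p ≡ height t → length q ≡ height t →
     LeftOf q p → At p t → At q t)

-- The associated unrooted tree: the root is removed and its two
-- incident edges are merged into the single edge `mid`.

UVtx : Tree → Set
UVtx leaf       = ⊤        -- degenerate (one-leaf) case, not used
UVtx (node s u) = Vtx s ⊎ Vtx u

data UEdge : Tree → Set where
  mid : ∀ {s u} → UEdge (node s u)
  inA : ∀ {s u} → Edge s → UEdge (node s u)
  inB : ∀ {s u} → Edge u → UEdge (node s u)

uends : ∀ {t} → UEdge t → UVtx t × UVtx t
uends mid     = inj₁ root , inj₂ root
uends (inA e) = inj₁ (top e) , inj₁ (bot e)
uends (inB e) = inj₂ (top e) , inj₂ (bot e)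

uleaf : ∀ {t} → Leaf t → UVtx t
uleaf here    = tt
uleaf (inl x) = inj₁ (leafVtx x)
uleaf (inr x) = inj₂ (leafVtx x)

-- A cut is a finite set of edges (a duplicate-free
-- list).  Vertices x, y are in the same tree of the forest obtained by
-- removing C iff they are joined by a walk using only edges not in C.

AdjAfter : ∀ {t} → List (UEdge t) → UVtx t → UVtx t → Set
AdjAfter {t} C x y =
  Σ (UEdge t) λ e → ¬ (e ∈ C) × (uends e ≡ (x , y) ⊎ uends e ≡ (y , x))

ConnAfter : ∀ {t} → List (UEdge t) → UVtx t → UVtx t → Set
ConnAfter C = Star (AdjAfter C)

IsMonoCut : ∀ {t} → (Leaf t → Set) → List (UEdge t) → Set
IsMonoCut {t} A C =
  (v : UVtx t) →
    (∀ x → ConnAfter C v (uleaf x) → A x) ⊎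
    (∀ x → ConnAfter C v (uleaf x) → ¬ A x)

MinMonoAtLeast : ∀ (t : Tree) → (Leaf t → Set) → ℕ → Set
MinMonoAtLeast t A k =
  (C : List (UEdge t)) → Unique C → IsMonoCut A C → k ≤ length C

module Submission where

-- A cut of the unrooted tree is described on the rooted tree by a
-- Boolean marking of its edges.  Call a tree k-hard if for every injective
-- numbering f of its leaves there is a threshold j, with leaves on both sides,
-- such that every marking separating the leaves {f < j} from {f ≥ j} marks at
-- least k edges.
--   * Every tree with two leaves is 1-hard (hard-node).
--   * If t₁, t₂, t₃ are k-hard then node (node t₁ t₂) t₃ is (k+1)-hard
--     (hard-step): use the threshold of the subtree whose threshold is the
--     median; a low leaf of the subtree with the smallest threshold and a high
--     leaf of the one with the largest must be separated by an edge outside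
--     the median subtree, on top of the k edges inside it.
--   * Hence trees full to depth 2k+1 are (k+1)-hard (hard-full), and so are
--     almost perfect trees of height 2k+1 with more than a_k leaves
--     (hard-shape): the only grandchild subtree that is not full enough again
--     has more than a_{k-1} leaves.  Comparing the height with 2k covers all
--     almost perfect trees with more than a_k leaves (hard-almost-perfect).
-- Finally a monochromatic cut C for [j] induces a marking with at most |C|
-- marked edges that separates {f < j} from {f ≥ j} (monochromatic-cut-bound),
-- and the bijection with Fin n shows that the tree has at least n leaves.

open import Defs
open import Data.Nat using (ℕ; _+_; _∸_; _≤_; _<_)
open import Data.Fin using (Fin; toℕ)
open import Data.Product using (Σ; _×_)
open import Function.Bundles using (_↔_; Inverse)

open import Data.Nat using (zero; suc; z≤n; s≤s; _^_; _⊔_; _*_)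
open import Data.Nat.Properties
open import Data.Nat.Tactic.RingSolver using (solve-∀)
open import Data.Bool using (Bool; true; false; _∨_)
open import Data.Bool.Properties using (∨-comm; ∨-conicalˡ; ∨-conicalʳ)
open import Data.Sum using (_⊎_; inj₁; inj₂; [_,_]′)
open import Data.Product using (_,_)
open import Data.Empty using (⊥-elim)
open import Data.List using (List; []; _∷_; length)
open import Data.List.Relation.Unary.Any using (here; there)
open import Data.List.Membership.Propositional using (_∈_)
open import Data.Fin using (_↑ˡ_; _↑ʳ_; splitAt) renaming (zero to fzero)
open import Data.Fin.Properties using (splitAt-↑ˡ; splitAt-↑ʳ; injective⇒≤; toℕ-injective; toℕ<n)
open import Function using (_∘_)
open import Function.Bundles using (Injection)
open import Function.Definitions using (Injective)
open import Function.Properties.Inverse using (↔-sym; ↔⇒↣)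
open import Relation.Binary.Definitions using (Tri; tri<; tri≈; tri>)
open import Relation.Binary.PropositionalEquality
open import Relation.Binary.Construct.Closure.ReflexiveTransitive
  using (ε; _◅_; _◅◅_) renaming (reverse to reverse*)
open import Relation.Nullary using (¬_; yes; no)

Marking : Tree → Set
Marking t = Edge t → Bool

none : ∀ {t} → Marking t
none _ = false

markL : ∀ {s u} → Marking (node s u) → Marking s
markL K e = K (el e)

markR : ∀ {s u} → Marking (node s u) → Marking u
markR K e = K (er e)

withL : ∀ {s u} → Marking (node s u) → Marking s → Marking (node s u)
withL K K′ down-l = K down-l
withL K K′ down-r = K down-r
withL K K′ (el e) = K′ e
withL K K′ (er e) = K (er e)

withR : ∀ {s u} → Marking (node s u) → Marking u → Marking (node s u)
withR K K′ down-l = K down-l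
withR K K′ down-r = K down-r
withR K K′ (el e) = K (el e)
withR K K′ (er e) = K′ e

bit : Bool → ℕ
bit true  = 1
bit false = 0

count : (t : Tree) → Marking t → ℕ
count leaf       K = 0
count (node s u) K =
  (bit (K down-l) + bit (K down-r)) + (count s (markL K) + count u (markR K))

count-none : ∀ t → count t none ≡ 0
count-none leaf = refl
count-none (node s u) = cong₂ _+_ (count-none s) (count-none u)

count-downL : ∀ {s u} (K : Marking (node s u)) → bit (K down-l) ≤ count (node s u) K
count-downL {s} {u} K = ≤-trans (m≤m+n (bit (K down-l)) (bit (K down-r)))
  (m≤m+n _ (count s (markL K) + count u (markR K)))

count-downR : ∀ {s u} (K : Marking (node s u)) → bit (K down-r) ≤ count (node s u) K
count-downR {s} {u} K = ≤-trans (m≤n+m (bit (K down-r)) (bit (K down-l)))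
  (m≤m+n _ (count s (markL K) + count u (markR K)))

count-left : ∀ {s u} (K : Marking (node s u)) → count s (markL K) ≤ count (node s u) K
count-left {s} {u} K = ≤-trans (m≤m+n (count s (markL K)) (count u (markR K)))
  (m≤n+m _ (bit (K down-l) + bit (K down-r)))

count-right : ∀ {s u} (K : Marking (node s u)) → count u (markR K) ≤ count (node s u) K
count-right {s} {u} K = ≤-trans (m≤n+m (count u (markR K)) (count s (markL K)))
  (m≤n+m _ (bit (K down-l) + bit (K down-r)))

count-withL : ∀ {s u} (K : Marking (node s u)) K′ x →
  count s (markL K) ≡ count s K′ + x → count (node s u) K ≡ count (node s u) (withL K K′) + x
count-withL {s} {u} K K′ x eq = begin
    d + (count s (markL K) + c)   ≡⟨ cong (λ m → d + (m + c)) eq ⟩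
    d + ((count s K′ + x) + c)    ≡⟨ regroup d (count s K′) x c ⟩
    (d + (count s K′ + c)) + x    ∎
  where
  open ≡-Reasoning
  d = bit (K down-l) + bit (K down-r)
  c = count u (markR K)
  regroup : ∀ d m x c → d + ((m + x) + c) ≡ (d + (m + c)) + x
  regroup = solve-∀

count-withR : ∀ {s u} (K : Marking (node s u)) K′ x →
  count u (markR K) ≡ count u K′ + x → count (node s u) K ≡ count (node s u) (withR K K′) + x
count-withR {s} {u} K K′ x eq = begin
    d + (c + count u (markR K))   ≡⟨ cong (λ m → d + (c + m)) eq ⟩
    d + (c + (count u K′ + x))    ≡⟨ regroup d c (count u K′) x ⟩
    (d + (c + count u K′)) + x    ∎
  where
  open ≡-Reasoning
  d = bit (K down-l) + bit (K down-r)
  c = count s (markL K)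
  regroup : ∀ d c m x → d + (c + (m + x)) ≡ (d + (c + m)) + x
  regroup = solve-∀

count-emptied : ∀ t (K : Marking t) → count t K ≡ count t none + count t K
count-emptied t K = cong (_+ count t K) (sym (count-none t))

cutOff : (t : Tree) → Marking t → Leaf t → Bool
cutOff leaf       K here    = false
cutOff (node s u) K (inl x) = K down-l ∨ cutOff s (markL K) x
cutOff (node s u) K (inr x) = K down-r ∨ cutOff u (markR K) x

separates : (t : Tree) → Marking t → Leaf t → Leaf t → Bool
separates leaf         K here    here    = false
separates (node s u)   K (inl x) (inl y) = separates s (markL K) x y
separates (node s u)   K (inr x) (inr y) = separates u (markR K) x y
separates t@(node s u) K (inl x) (inr y) = cutOff t K (inl x) ∨ cutOff t K (inr y)
separates t@(node s u) K (inr x) (inl y) = cutOff t K (inr x) ∨ cutOff t K (inl y)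

∨-true : ∀ x y → x ∨ y ≡ true → x ≡ true ⊎ y ≡ true
∨-true true  _ _ = inj₁ refl
∨-true false _ e = inj₂ e

bit-true : ∀ {x} → x ≡ true → 1 ≤ bit x
bit-true refl = ≤-refl

cutOff⇒count : ∀ t K x → cutOff t K x ≡ true → 1 ≤ count t K
cutOff⇒count leaf K here ()
cutOff⇒count (node s u) K (inl x) off with ∨-true (K down-l) (cutOff s (markL K) x) off
... | inj₁ marked = ≤-trans (bit-true marked) (count-downL K)
... | inj₂ below  = ≤-trans (cutOff⇒count s (markL K) x below) (count-left K)
cutOff⇒count (node s u) K (inr x) off with ∨-true (K down-r) (cutOff u (markR K) x) off
... | inj₁ marked = ≤-trans (bit-true marked) (count-downR K)
... | inj₂ below  = ≤-trans (cutOff⇒count u (markR K) x below) (count-right K)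

separates⇒count : ∀ t K x y → separates t K x y ≡ true → 1 ≤ count t K
separates⇒count leaf K here here ()
separates⇒count (node s u) K (inl x) (inl y) sep =
  ≤-trans (separates⇒count s (markL K) x y sep) (count-left K)
separates⇒count (node s u) K (inr x) (inr y) sep =
  ≤-trans (separates⇒count u (markR K) x y sep) (count-right K)
separates⇒count t@(node s u) K (inl x) (inr y) sep
  with ∨-true (cutOff t K (inl x)) (cutOff t K (inr y)) sep
... | inj₁ off = cutOff⇒count t K (inl x) off
... | inj₂ off = cutOff⇒count t K (inr y) off
separates⇒count t@(node s u) K (inr x) (inl y) sep
  with ∨-true (cutOff t K (inr x)) (cutOff t K (inl y)) sep
... | inj₁ off = cutOff⇒count t K (inr x) off
... | inj₂ off = cutOff⇒count t K (inl y) off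

Separating : (t : Tree) → (Leaf t → ℕ) → ℕ → Marking t → Set
Separating t f j K = ∀ x y → f x < j → j ≤ f y → separates t K x y ≡ true

record Threshold (t : Tree) (f : Leaf t → ℕ) (k : ℕ) : Set where
  constructor threshold
  field
    level : ℕ
    low   : Leaf t
    low<  : f low < level
    high  : Leaf t
    ≤high : level ≤ f high
    needs : ∀ K → Separating t f level K → k ≤ count t K
open Threshold

Hard : Tree → ℕ → Set
Hard t k = (f : Leaf t → ℕ) → Injective _≡_ _≡_ f → Threshold t f k

leftmost : (t : Tree) → Leaf t
leftmost leaf       = here
leftmost (node s u) = inl (leftmost s)

-- the larger label of two leaves on different sides of the root is a threshold
hard-node : ∀ {s u} → Hard (node s u) 1
hard-node {s} {u} f f-inj = compare (<-cmp (f x) (f y))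
  where
  x y : Leaf (node s u)
  x = inl (leftmost s)
  y = inr (leftmost u)
  compare : Tri (f x < f y) (f x ≡ f y) (f y < f x) → Threshold (node s u) f 1
  compare (tri< x<y _ _) =
    threshold (f y) x x<y y ≤-refl λ K sep → separates⇒count _ K x y (sep x y x<y ≤-refl)
  compare (tri≈ _ fx≡fy _) with f-inj fx≡fy
  ... | ()
  compare (tri> _ _ y<x) =
    threshold (f x) y y<x x ≤-refl λ K sep → separates⇒count _ K y x (sep y x y<x ≤-refl)

-- A subtree s in a fixed position inside t, with the erasure of its edges.
record Slot (s t : Tree) : Set where
  field
    leafAt           : Leaf s → Leaf t
    leafAt-injective : Injective _≡_ _≡_ leafAt
    edgeAt           : Edge s → Edge t
    separates-at     : ∀ K x y →
      separates t K (leafAt x) (leafAt y) ≡ separates s (λ e → K (edgeAt e)) x y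
    erase            : Marking t → Marking t
    count-erase      : ∀ K → count t K ≡ count t (erase K) + count s (λ e → K (edgeAt e))
open Slot

-- Median step: the threshold of the slot M, flanked by a low leaf of the slot
-- Lo and a high leaf of the slot Hi whose separation ignores the edges of M,
-- needs one edge more than inside M.
climb : ∀ {m l h t k} {f : Leaf t → ℕ}
  (M : Slot m t) (θ : Threshold m (f ∘ leafAt M) k)
  (Lo : Slot l t) (θl : Threshold l (f ∘ leafAt Lo) k)
  (Hi : Slot h t) (θh : Threshold h (f ∘ leafAt Hi) k) →
  level θl ≤ level θ → level θ ≤ level θh →
  (∀ K → separates t (erase M K) (leafAt Lo (low θl)) (leafAt Hi (high θh))
       ≡ separates t K (leafAt Lo (low θl)) (leafAt Hi (high θh))) →
  Threshold t f (suc k)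
climb {m} {t = t} {k} {f} M θ Lo θl Hi θh l≤m m≤h independent =
  threshold (level θ) (leafAt M (low θ)) (low< θ) (leafAt M (high θ)) (≤high θ) needs′
  where
  needs′ : ∀ K → Separating t f (level θ) K → suc k ≤ count t K
  needs′ K sep = begin
      1 + k                                              ≤⟨ +-mono-≤ outside inside ⟩
      count t (erase M K) + count m (λ e → K (edgeAt M e)) ≡⟨ sym (count-erase M K) ⟩
      count t K                                          ∎
    where
    open ≤-Reasoning
    p = leafAt Lo (low θl)
    q = leafAt Hi (high θh)
    outside : 1 ≤ count t (erase M K)
    outside = separates⇒count t (erase M K) p q
      (trans (independent K) (sep p q (<-≤-trans (low< θl) l≤m) (≤-trans m≤h (≤high θh))))
    inside : k ≤ count m (λ e → K (edgeAt M e))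
    inside = needs θ _ λ x y x<j j≤y →
      trans (sym (separates-at M K x y)) (sep (leafAt M x) (leafAt M y) x<j j≤y)

module Grandchildren (t₁ t₂ t₃ : Tree) where
  T₃ : Tree
  T₃ = node (node t₁ t₂) t₃

  slot₁ : Slot t₁ T₃
  slot₁ = record
    { leafAt           = λ x → inl (inl x)
    ; leafAt-injective = λ { refl → refl }
    ; edgeAt           = λ e → el (el e)
    ; separates-at     = λ _ _ _ → refl
    ; erase            = λ K → withL K (withL (markL K) none)
    ; count-erase      = λ K → count-withL K (withL (markL K) none) _
                                 (count-withL (markL K) none _ (count-emptied t₁ _))
    }

  slot₂ : Slot t₂ T₃
  slot₂ = record
    { leafAt           = λ x → inl (inr x)
    ; leafAt-injective = λ { refl → refl }
    ; edgeAt           = λ e → el (er e)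
    ; separates-at     = λ _ _ _ → refl
    ; erase            = λ K → withL K (withR (markL K) none)
    ; count-erase      = λ K → count-withL K (withR (markL K) none) _
                                 (count-withR (markL K) none _ (count-emptied t₂ _))
    }

  slot₃ : Slot t₃ T₃
  slot₃ = record
    { leafAt           = inr
    ; leafAt-injective = λ { refl → refl }
    ; edgeAt           = er
    ; separates-at     = λ _ _ _ → refl
    ; erase            = λ K → withR K none
    ; count-erase      = λ K → count-withR K none _ (count-emptied t₃ _)
    }

hard-step : ∀ {t₁ t₂ t₃ k} → Hard t₁ k → Hard t₂ k → Hard t₃ k →
  Hard (node (node t₁ t₂) t₃) (suc k)
hard-step {t₁} {t₂} {t₃} {k} H₁ H₂ H₃ f f-inj =
  by-median (≤-total (level θ₁) (level θ₂)) (≤-total (level θ₂) (level θ₃))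
            (≤-total (level θ₁) (level θ₃))
  where
  open Grandchildren t₁ t₂ t₃
  restricted : ∀ {s} (S : Slot s T₃) → Injective _≡_ _≡_ (f ∘ leafAt S)
  restricted S e = leafAt-injective S (f-inj e)
  θ₁ : Threshold t₁ (f ∘ leafAt slot₁) k
  θ₁ = H₁ _ (restricted slot₁)
  θ₂ : Threshold t₂ (f ∘ leafAt slot₂) k
  θ₂ = H₂ _ (restricted slot₂)
  θ₃ : Threshold t₃ (f ∘ leafAt slot₃) k
  θ₃ = H₃ _ (restricted slot₃)
  by-median : level θ₁ ≤ level θ₂ ⊎ level θ₂ ≤ level θ₁ →
              level θ₂ ≤ level θ₃ ⊎ level θ₃ ≤ level θ₂ →
              level θ₁ ≤ level θ₃ ⊎ level θ₃ ≤ level θ₁ → Threshold T₃ f (suc k)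
  by-median (inj₁ 1≤2) (inj₁ 2≤3) _ = climb slot₂ θ₂ slot₁ θ₁ slot₃ θ₃ 1≤2 2≤3 λ _ → refl
  by-median (inj₁ 1≤2) (inj₂ 3≤2) (inj₁ 1≤3) = climb slot₃ θ₃ slot₁ θ₁ slot₂ θ₂ 1≤3 3≤2 λ _ → refl
  by-median (inj₁ 1≤2) (inj₂ 3≤2) (inj₂ 3≤1) = climb slot₁ θ₁ slot₃ θ₃ slot₂ θ₂ 3≤1 1≤2 λ _ → refl
  by-median (inj₂ 2≤1) _ (inj₁ 1≤3) = climb slot₁ θ₁ slot₂ θ₂ slot₃ θ₃ 2≤1 1≤3 λ _ → refl
  by-median (inj₂ 2≤1) (inj₁ 2≤3) (inj₂ 3≤1) = climb slot₃ θ₃ slot₂ θ₂ slot₁ θ₁ 2≤3 3≤1 λ _ → refl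
  by-median (inj₂ 2≤1) (inj₂ 3≤2) (inj₂ 3≤1) = climb slot₂ θ₂ slot₃ θ₃ slot₁ θ₁ 3≤2 2≤1 λ _ → refl

leaves : Tree → ℕ
leaves leaf       = 1
leaves (node s u) = leaves s + leaves u

data Perfect : ℕ → Tree → Set where
  perfect-leaf : Perfect 0 leaf
  perfect-node : ∀ {d l r} → Perfect d l → Perfect d r → Perfect (suc d) (node l r)

data Full : ℕ → Tree → Set where
  full-any  : ∀ {t} → Full 0 t
  full-node : ∀ {d l r} → Full d l → Full d r → Full (suc d) (node l r)

-- Shape h t: levels 0 … h of t are full, no vertex is deeper than h + 1, and
-- the vertices of depth h + 1 are the leftmost ones.  So the last level ends
-- either in the left subtree (the right one is then perfect of height h) or
-- in the right one (the left one is then perfect of height h + 1).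
data Shape : ℕ → Tree → Set where
  shape-leaf   : Shape 0 leaf
  shape-cherry : Shape 0 (node leaf leaf)
  shape-left   : ∀ {h l r} → Shape h l → Perfect h r → Shape (suc h) (node l r)
  shape-right  : ∀ {h l r} → Perfect (suc h) l → Shape h r → Shape (suc h) (node l r)

perfect-full : ∀ {d t} → Perfect d t → Full d t
perfect-full perfect-leaf       = full-any
perfect-full (perfect-node l r) = full-node (perfect-full l) (perfect-full r)

full-weaken : ∀ {d d′ t} → d ≤ d′ → Full d′ t → Full d t
full-weaken z≤n        _               = full-any
full-weaken (s≤s d≤d′) (full-node l r) = full-node (full-weaken d≤d′ l) (full-weaken d≤d′ r)

shape-full : ∀ {h t} → Shape h t → Full h t
shape-full shape-leaf        = full-any
shape-full shape-cherry      = full-any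
shape-full (shape-left l r)  = full-node (shape-full l) (perfect-full r)
shape-full (shape-right l r) = full-node (full-weaken (n≤1+n _) (perfect-full l)) (shape-full r)

perfect-leaves : ∀ {d t} → Perfect d t → leaves t ≡ 2 ^ d
perfect-leaves perfect-leaf = refl
perfect-leaves (perfect-node {d} {t₁} {t₂} l r) = begin
  leaves t₁ + leaves t₂ ≡⟨ cong₂ _+_ (perfect-leaves l) (perfect-leaves r) ⟩
  2 ^ d + 2 ^ d        ≡⟨ cong (2 ^ d +_) (sym (+-identityʳ (2 ^ d))) ⟩
  2 ^ suc d            ∎
  where open ≡-Reasoning

shape-leaves : ∀ {h t} → Shape h t → leaves t ≤ 2 ^ suc h
shape-leaves shape-leaf   = s≤s z≤n
shape-leaves shape-cherry = ≤-refl
shape-leaves (shape-left {h} {t₁} {t₂} l r) = begin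
  leaves t₁ + leaves t₂        ≤⟨ +-mono-≤ (shape-leaves l) (≤-reflexive (perfect-leaves r)) ⟩
  2 ^ suc h + 2 ^ h            ≤⟨ +-monoʳ-≤ (2 ^ suc h) (^-monoʳ-≤ 2 (n≤1+n h)) ⟩
  2 ^ suc h + 2 ^ suc h        ≡⟨ cong (2 ^ suc h +_) (sym (+-identityʳ (2 ^ suc h))) ⟩
  2 ^ suc (suc h)              ∎
  where open ≤-Reasoning
shape-leaves (shape-right {h} {t₁} {t₂} l r) = begin
  leaves t₁ + leaves t₂        ≤⟨ +-mono-≤ (≤-reflexive (perfect-leaves l)) (shape-leaves r) ⟩
  2 ^ suc h + 2 ^ suc h        ≡⟨ cong (2 ^ suc h +_) (sym (+-identityʳ (2 ^ suc h))) ⟩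
  2 ^ suc (suc h)              ∎
  where open ≤-Reasoning

twice : ℕ → ℕ
twice zero    = zero
twice (suc k) = suc (suc (twice k))

pow-twice : ∀ k → 2 ^ twice k ≡ 4 ^ k
pow-twice zero    = refl
pow-twice (suc k) = trans (sym (*-assoc 2 2 (2 ^ twice k))) (cong (4 *_) (pow-twice k))

geom4-≥ : ∀ k → 4 ^ k ≤ geom4 k
geom4-≥ zero    = ≤-refl
geom4-≥ (suc k) = m≤n+m (4 ^ suc k) (geom4 k)

hard-full : ∀ k {t} → Full (suc (twice k)) t → Hard t (suc k)
hard-full zero    (full-node _ _) = hard-node
hard-full (suc k) (full-node (full-node full₁ full₂) full₃) =
  hard-step (hard-full k full₁) (hard-full k full₂) (hard-full k (full-weaken (n≤1+n _) full₃))

-- If the last level ends in the middle grandchild, the outer two are perfect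
-- with 2·4^k leaves each, so the middle one carries more than a_k leaves.
middle-excess : ∀ {k t₁ t₂ t₃} → Perfect (suc (twice k)) t₁ → Perfect (suc (twice k)) t₃ →
  geom4 (suc k) < leaves (node (node t₁ t₂) t₃) → geom4 k < leaves t₂
middle-excess {k} {t₁} {t₂} {t₃} perfect₁ perfect₃ big =
  +-cancelʳ-≤ (4 * 4 ^ k) (suc (geom4 k)) (leaves t₂) (≤-trans big (≤-reflexive total))
  where
  open ≡-Reasoning
  regroup : ∀ x m → (2 * x + m) + 2 * x ≡ m + 4 * x
  regroup = solve-∀
  total : leaves t₁ + leaves t₂ + leaves t₃ ≡ leaves t₂ + 4 * 4 ^ k
  total = begin
    leaves t₁ + leaves t₂ + leaves t₃
      ≡⟨ cong₂ (λ x z → x + leaves t₂ + z) (perfect-leaves perfect₁) (perfect-leaves perfect₃) ⟩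
    2 * 2 ^ twice k + leaves t₂ + 2 * 2 ^ twice k
      ≡⟨ cong (λ x → 2 * x + leaves t₂ + 2 * x) (pow-twice k) ⟩
    2 * 4 ^ k + leaves t₂ + 2 * 4 ^ k
      ≡⟨ regroup (4 ^ k) (leaves t₂) ⟩
    leaves t₂ + 4 * 4 ^ k ∎

left-deficit : ∀ {k t₁ t₂ t₃} → Shape (twice k) t₁ → Perfect (twice k) t₂ →
  Perfect (suc (twice k)) t₃ → leaves (node (node t₁ t₂) t₃) ≤ geom4 (suc k)
left-deficit {k} {t₁} {t₂} {t₃} shape₁ perfect₂ perfect₃ = begin
  leaves t₁ + leaves t₂ + leaves t₃
    ≤⟨ +-monoˡ-≤ (leaves t₃) (+-monoˡ-≤ (leaves t₂) (shape-leaves shape₁)) ⟩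
  2 * 2 ^ twice k + leaves t₂ + leaves t₃
    ≡⟨ cong₂ (λ y z → 2 * 2 ^ twice k + y + z) (perfect-leaves perfect₂) (perfect-leaves perfect₃) ⟩
  2 * 2 ^ twice k + 2 ^ twice k + 2 * 2 ^ twice k
    ≡⟨ cong (λ x → 2 * x + x + 2 * x) (pow-twice k) ⟩
  2 * 4 ^ k + 4 ^ k + 2 * 4 ^ k
    ≡⟨ regroup (4 ^ k) ⟩
  4 ^ k + 4 * 4 ^ k
    ≤⟨ +-monoˡ-≤ (4 * 4 ^ k) (geom4-≥ k) ⟩
  geom4 k + 4 * 4 ^ k ∎
  where
  open ≤-Reasoning
  regroup : ∀ x → 2 * x + x + 2 * x ≡ x + 4 * x
  regroup = solve-∀

hard-shape : ∀ k {t} → Shape (twice k) t → geom4 k < leaves t → Hard t (suc k)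
hard-shape zero shape-leaf (s≤s ())
hard-shape zero shape-cherry _ = hard-node
hard-shape (suc k) (shape-right (perfect-node perfect₁ perfect₂) shape₃) _ =
  hard-step (hard-full k (perfect-full perfect₁)) (hard-full k (perfect-full perfect₂))
            (hard-full k (shape-full shape₃))
hard-shape (suc k) (shape-left {r = t₃} (shape-right {r = t₂} perfect₁ shape₂) perfect₃) big =
  hard-step (hard-full k (perfect-full perfect₁))
            (hard-shape k shape₂ (middle-excess {t₂ = t₂} {t₃ = t₃} perfect₁ perfect₃ big))
            (hard-full k (perfect-full perfect₃))
hard-shape (suc k) (shape-left (shape-left shape₁ perfect₂) perfect₃) big =
  ⊥-elim (<⇒≱ big (left-deficit shape₁ perfect₂ perfect₃))

at-depth : ∀ {p t} → At p t → length p ≤ height t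
at-depth at-root = z≤n
at-depth (at-L {s = s} {u} at) = s≤s (≤-trans (at-depth at) (m≤m⊔n (height s) (height u)))
at-depth (at-R {s = s} {u} at) = s≤s (≤-trans (at-depth at) (m≤n⊔m (height s) (height u)))

deepest : ∀ t → Σ (List Dir) λ p → At p t × length p ≡ height t
deepest leaf = [] , at-root , refl
deepest (node s u) with ≤-total (height s) (height u) | deepest s | deepest u
... | inj₁ s≤u | _ | p , at , len =
  R ∷ p , at-R at , cong suc (trans len (sym (m≤n⇒m⊔n≡n s≤u)))
... | inj₂ u≤s | p , at , len | _ =
  L ∷ p , at-L at , cong suc (trans len (sym (m≥n⇒m⊔n≡m u≤s)))

unL : ∀ {p s u} → At (L ∷ p) (node s u) → At p s
unL (at-L at) = at

unR : ∀ {p s u} → At (R ∷ p) (node s u) → At p u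
unR (at-R at) = at

-- the conditions defining an almost perfect tree of height h + 1
record Layered (h : ℕ) (t : Tree) : Set where
  field
    present : ∀ p → length p ≤ h → At p t
    bounded : ∀ p → At p t → length p ≤ suc h
    packed  : ∀ p q → length p ≡ suc h → length q ≡ suc h → LeftOf q p → At p t → At q t
open Layered

layered : ∀ {s u} → IsAlmostPerfect (node s u) → Layered (height s ⊔ height u) (node s u)
layered (levels , last) = record
  { present = λ p len → levels p (s≤s len)
  ; bounded = λ p at → at-depth at
  ; packed  = last
  }

layered-left : ∀ {h l r} → Layered (suc h) (node l r) → Layered h l
layered-left lay = record
  { present = λ p len → unL (present lay (L ∷ p) (s≤s len))
  ; bounded = λ p at → ≤-pred (bounded lay (L ∷ p) (at-L at))
  ; packed  = λ p q p-len q-len q<p at →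
      unL (packed lay (L ∷ p) (L ∷ q) (cong suc p-len) (cong suc q-len) (there q<p) (at-L at))
  }

layered-right : ∀ {h l r} → Layered (suc h) (node l r) → Layered h r
layered-right lay = record
  { present = λ p len → unR (present lay (R ∷ p) (s≤s len))
  ; bounded = λ p at → ≤-pred (bounded lay (R ∷ p) (at-R at))
  ; packed  = λ p q p-len q-len q<p at →
      unR (packed lay (R ∷ p) (R ∷ q) (cong suc p-len) (cong suc q-len) (there q<p) (at-R at))
  }

perfect-of : ∀ d t → (∀ p → length p ≤ d → At p t) → (∀ p → At p t → length p ≤ d) → Perfect d t
perfect-of zero leaf _ _ = perfect-leaf
perfect-of zero (node l r) _ bound with bound (L ∷ []) (at-L at-root)
... | ()
perfect-of (suc d) leaf present′ _ with present′ (L ∷ []) (s≤s z≤n)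
... | ()
perfect-of (suc d) (node l r) present′ bound = perfect-node
  (perfect-of d l (λ p len → unL (present′ (L ∷ p) (s≤s len))) (λ p at → ≤-pred (bound (L ∷ p) (at-L at))))
  (perfect-of d r (λ p len → unR (present′ (R ∷ p) (s≤s len))) (λ p at → ≤-pred (bound (R ∷ p) (at-R at))))

left-perfect : ∀ {h l r} → Layered (suc h) (node l r) → suc h ≤ height r → Perfect (suc h) l
left-perfect {h} {l} {r} lay deep with deepest r
... | p₀ , at₀ , len₀ =
  perfect-of (suc h) l present′ (λ p at → ≤-pred (bounded lay (L ∷ p) (at-L at)))
  where
  p₀-len : length p₀ ≡ suc h
  p₀-len = ≤-antisym (≤-pred (bounded lay (R ∷ p₀) (at-R at₀))) (subst (suc h ≤_) (sym len₀) deep)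
  present′ : ∀ p → length p ≤ suc h → At p l
  present′ p len with m≤n⇒m<n∨m≡n len
  ... | inj₁ shorter = unL (present lay (L ∷ p) shorter)
  ... | inj₂ same    = unL (packed lay (R ∷ p₀) (L ∷ p) (cong suc p₀-len) (cong suc same) lr (at-R at₀))

shape-of : ∀ h t → Layered h t → Shape h t
shape-of zero leaf _ = shape-leaf
shape-of zero (node leaf leaf) _ = shape-cherry
shape-of zero (node (node _ _) _) lay with bounded lay (L ∷ L ∷ []) (at-L (at-L at-root))
... | s≤s ()
shape-of zero (node leaf (node _ _)) lay with bounded lay (R ∷ L ∷ []) (at-R (at-L at-root))
... | s≤s ()
shape-of (suc h) leaf lay with present lay (L ∷ []) (s≤s z≤n)
... | ()
shape-of (suc h) (node l r) lay with height r ≤? h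
... | yes shallow = shape-left (shape-of h l (layered-left lay))
  (perfect-of h r (λ p len → unR (present lay (R ∷ p) (s≤s len))) (λ p at → ≤-trans (at-depth at) shallow))
... | no deep = shape-right (left-perfect lay (≰⇒> deep)) (shape-of h r (layered-right lay))

few-leaves : ∀ k {h t} → Shape h t → h < twice k → leaves t ≤ a k
few-leaves zero    _ ()
few-leaves (suc k) {h} {t} shape h<2k = begin
  leaves t               ≤⟨ shape-leaves shape ⟩
  2 ^ suc h              ≤⟨ ^-monoʳ-≤ 2 h<2k ⟩
  2 ^ twice (suc k)      ≡⟨ pow-twice (suc k) ⟩
  4 ^ suc k              ≤⟨ geom4-≥ (suc k) ⟩
  geom4 (suc k)          ∎
  where open ≤-Reasoning

geom4<leaves : ∀ k {N} → 2 ≤ N → a k < N → geom4 k < N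
geom4<leaves zero    two _   = two
geom4<leaves (suc k) _   big = big

-- Compare the height with 2k: too low is impossible, exactly 2k is covered by
-- hard-shape, and higher trees are full to depth 2k + 1.
hard-by-height : ∀ k h {t} → Shape h t → 2 ≤ leaves t → a k < leaves t → Hard t (suc k)
hard-by-height k h shape two big with <-cmp h (twice k)
... | tri< h<2k _ _ = ⊥-elim (<⇒≱ big (few-leaves k shape h<2k))
... | tri≈ _ refl _ = hard-shape k shape (geom4<leaves k two big)
... | tri> _ _ 2k<h = hard-full k (full-weaken 2k<h (shape-full shape))

hard-almost-perfect : ∀ k t → IsAlmostPerfect t → 2 ≤ leaves t → a k < leaves t → Hard t (suc k)
hard-almost-perfect k leaf       _      (s≤s ()) _
hard-almost-perfect k (node s u) almost two big =
  hard-by-height k _ (shape-of _ _ (layered almost)) two big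

index : ∀ t → Leaf t → Fin (leaves t)
index leaf       here    = fzero
index (node s u) (inl x) = index s x ↑ˡ leaves u
index (node s u) (inr x) = leaves s ↑ʳ index u x

leafAtIndex : ∀ t → Fin (leaves t) → Leaf t
leafAtIndex leaf       _ = here
leafAtIndex (node s u) i = [ inl ∘ leafAtIndex s , inr ∘ leafAtIndex u ]′ (splitAt (leaves s) i)

leafAtIndex-index : ∀ t x → leafAtIndex t (index t x) ≡ x
leafAtIndex-index leaf here = refl
leafAtIndex-index (node s u) (inl x)
  rewrite splitAt-↑ˡ (leaves s) (index s x) (leaves u) = cong inl (leafAtIndex-index s x)
leafAtIndex-index (node s u) (inr x)
  rewrite splitAt-↑ʳ (leaves s) (leaves u) (index u x) = cong inr (leafAtIndex-index u x)

index-injective : ∀ t → Injective _≡_ _≡_ (index t)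
index-injective t {x} {y} same = begin
  x                              ≡⟨ sym (leafAtIndex-index t x) ⟩
  leafAtIndex t (index t x)      ≡⟨ cong (leafAtIndex t) same ⟩
  leafAtIndex t (index t y)      ≡⟨ leafAtIndex-index t y ⟩
  y                              ∎
  where open ≡-Reasoning

numbering-bound : ∀ {t n} → Leaf t ↔ Fin n → n ≤ leaves t
numbering-bound {t} σ = injective⇒≤ {f = index t ∘ Inverse.from σ}
  (λ same → Injection.injective (↔⇒↣ (↔-sym σ)) (index-injective t same))

sameEdge : ∀ {t} → Edge t → Marking t
sameEdge down-l down-l = true
sameEdge down-r down-r = true
sameEdge (el e) (el e′) = sameEdge e e′
sameEdge (er e) (er e′) = sameEdge e e′
sameEdge _      _       = false

sameEdge-refl : ∀ {t} (e : Edge t) → sameEdge e e ≡ true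
sameEdge-refl down-l = refl
sameEdge-refl down-r = refl
sameEdge-refl (el e) = sameEdge-refl e
sameEdge-refl (er e) = sameEdge-refl e

count-sameEdge : ∀ t (e : Edge t) → count t (sameEdge e) ≡ 1
count-sameEdge (node s u) down-l = cong (λ m → 1 + m) (cong₂ _+_ (count-none s) (count-none u))
count-sameEdge (node s u) down-r = cong (λ m → 1 + m) (cong₂ _+_ (count-none s) (count-none u))
count-sameEdge (node s u) (el e) = cong₂ _+_ (count-sameEdge s e) (count-none u)
count-sameEdge (node s u) (er e) = cong₂ _+_ (count-none s) (count-sameEdge u e)

bit-∨ : ∀ x y → bit (x ∨ y) ≤ bit x + bit y
bit-∨ true  _ = s≤s z≤n
bit-∨ false _ = ≤-refl

count-∨ : ∀ t (K₁ K₂ : Marking t) → count t (λ e → K₁ e ∨ K₂ e) ≤ count t K₁ + count t K₂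
count-∨ leaf _ _ = z≤n
count-∨ (node s u) K₁ K₂ = ≤-trans
  (+-mono-≤ (+-mono-≤ (bit-∨ (K₁ down-l) (K₂ down-l)) (bit-∨ (K₁ down-r) (K₂ down-r)))
            (+-mono-≤ (count-∨ s (markL K₁) (markL K₂)) (count-∨ u (markR K₁) (markR K₂))))
  (≤-reflexive (regroup (bit (K₁ down-l)) (bit (K₂ down-l)) (bit (K₁ down-r)) (bit (K₂ down-r))
                        (count s (markL K₁)) (count s (markL K₂))
                        (count u (markR K₁)) (count u (markR K₂))))
  where
  regroup : ∀ a a′ b b′ c c′ d d′ →
    ((a + a′) + (b + b′)) + ((c + c′) + (d + d′)) ≡ ((a + b) + (c + d)) + ((a′ + b′) + (c′ + d′))
  regroup = solve-∀

rooted : ∀ {s u} → UEdge (node s u) → Edge (node s u)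
rooted mid     = down-l
rooted (inA e) = el e
rooted (inB e) = er e

cutMarking : ∀ {s u} → List (UEdge (node s u)) → Marking (node s u)
cutMarking []      e = false
cutMarking (c ∷ C) e = sameEdge (rooted c) e ∨ cutMarking C e

count-cutMarking : ∀ {s u} (C : List (UEdge (node s u))) → count (node s u) (cutMarking C) ≤ length C
count-cutMarking {s} {u} [] = ≤-reflexive (count-none (node s u))
count-cutMarking (c ∷ C) = ≤-trans (count-∨ _ (sameEdge (rooted c)) (cutMarking C))
  (+-mono-≤ (≤-reflexive (count-sameEdge _ (rooted c))) (count-cutMarking C))

unmarked-∉ : ∀ {s u} (C : List (UEdge (node s u))) c → cutMarking C (rooted c) ≡ false → ¬ (c ∈ C)
unmarked-∉ (c ∷ C) .c unmarked (here refl)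
  with trans (sym (sameEdge-refl (rooted c))) (∨-conicalˡ _ (cutMarking C (rooted c)) unmarked)
... | ()
unmarked-∉ (c′ ∷ C) c unmarked (there c∈C) =
  unmarked-∉ C c (∨-conicalʳ (sameEdge (rooted c′) (rooted c)) _ unmarked) c∈C

module Walks {t : Tree} (C : List (UEdge t)) where

  adj-sym : ∀ {x y} → AdjAfter C x y → AdjAfter C y x
  adj-sym (e , e∉C , inj₁ ends) = e , e∉C , inj₂ ends
  adj-sym (e , e∉C , inj₂ ends) = e , e∉C , inj₁ ends

  Survives : (w : Tree) → (Vtx w → UVtx t) → Marking w → Set
  Survives w v K = ∀ e → K e ≡ false → AdjAfter C (v (top e)) (v (bot e))

  up-walk : ∀ w v K → Survives w v K →
    ∀ x → cutOff w K x ≡ false → ConnAfter C (v (leafVtx x)) (v root)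
  up-walk leaf v K _ here _ = ε
  up-walk (node w₁ w₂) v K survives (inl x) free =
    up-walk w₁ (λ z → v (inl z)) (markL K) (λ e → survives (el e)) x (∨-conicalʳ (K down-l) _ free)
      ◅◅ (adj-sym (survives down-l (∨-conicalˡ _ _ free)) ◅ ε)
  up-walk (node w₁ w₂) v K survives (inr x) free =
    up-walk w₂ (λ z → v (inr z)) (markR K) (λ e → survives (er e)) x (∨-conicalʳ (K down-r) _ free)
      ◅◅ (adj-sym (survives down-r (∨-conicalˡ _ _ free)) ◅ ε)

  sep-walk : ∀ w v K → Survives w v K →
    ∀ x y → separates w K x y ≡ false → ConnAfter C (v (leafVtx x)) (v (leafVtx y))
  sep-walk leaf v K _ here here _ = ε
  sep-walk (node w₁ w₂) v K survives (inl x) (inl y) free =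
    sep-walk w₁ (λ z → v (inl z)) (markL K) (λ e → survives (el e)) x y free
  sep-walk (node w₁ w₂) v K survives (inr x) (inr y) free =
    sep-walk w₂ (λ z → v (inr z)) (markR K) (λ e → survives (er e)) x y free
  sep-walk w@(node _ _) v K survives (inl x) (inr y) free =
    up-walk w v K survives (inl x) (∨-conicalˡ _ _ free)
      ◅◅ reverse* adj-sym (up-walk w v K survives (inr y) (∨-conicalʳ (cutOff w K (inl x)) _ free))
  sep-walk w@(node _ _) v K survives (inr x) (inl y) free =
    up-walk w v K survives (inr x) (∨-conicalˡ _ _ free)
      ◅◅ reverse* adj-sym (up-walk w v K survives (inl y) (∨-conicalʳ (cutOff w K (inr x)) _ free))

connected : ∀ {s u} (C : List (UEdge (node s u))) x y →
  separates (node s u) (cutMarking C) x y ≡ false → ConnAfter C (uleaf x) (uleaf y)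
connected {s} {u} C = joined
  where
  open Walks C
  K = cutMarking C
  left : Survives s inj₁ (markL K)
  left e free = inA e , unmarked-∉ C (inA e) free , inj₁ refl
  right : Survives u inj₂ (markR K)
  right e free = inB e , unmarked-∉ C (inB e) free , inj₁ refl
  across : K down-l ≡ false → AdjAfter C (inj₁ root) (inj₂ root)
  across free = mid , unmarked-∉ C mid free , inj₁ refl
  joined : ∀ x y → separates (node s u) K x y ≡ false → ConnAfter C (uleaf x) (uleaf y)
  joined (inl x) (inl y) free = sep-walk s inj₁ (markL K) left x y free
  joined (inr x) (inr y) free = sep-walk u inj₂ (markR K) right x y free
  joined (inl x) (inr y) free =
    up-walk s inj₁ (markL K) left x (∨-conicalʳ (K down-l) _ free-x)
      ◅◅ across (∨-conicalˡ _ _ free-x)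
      ◅  reverse* adj-sym (up-walk u inj₂ (markR K) right y (∨-conicalʳ (K down-r) _ free-y))
    where
    free-x = ∨-conicalˡ _ _ free
    free-y = ∨-conicalʳ (cutOff (node s u) K (inl x)) _ free
  joined (inr x) (inl y) free =
    reverse* adj-sym (joined (inl y) (inr x) (trans (∨-comm (cutOff (node s u) K (inl y)) (cutOff (node s u) K (inr x))) free))

-- A threshold needing k edges forces every monochromatic cut for the leaves
-- below it to have at least k edges: such a cut must separate every leaf
-- below the threshold from every leaf above it.
monochromatic-cut-bound : ∀ {t k} (f : Leaf t → ℕ) (θ : Threshold t f k) →
  MinMonoAtLeast t (λ x → f x < level θ) k
monochromatic-cut-bound {leaf} f (threshold _ here below here above _) =
  ⊥-elim (<⇒≱ below above)
monochromatic-cut-bound {node s u} {k} f θ C _ mono = begin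
  k                                ≤⟨ needs θ (cutMarking C) separating ⟩
  count (node s u) (cutMarking C)  ≤⟨ count-cutMarking C ⟩
  length C                         ∎
  where
  open ≤-Reasoning
  separating : Separating (node s u) f (level θ) (cutMarking C)
  separating x y x<j j≤y with separates (node s u) (cutMarking C) x y in free
  ... | true  = refl
  ... | false with mono (uleaf x)
  ...   | inj₁ all-below = ⊥-elim (<⇒≱ (all-below y (connected C x y free)) j≤y)
  ...   | inj₂ all-above = ⊥-elim (all-above x ε x<j)

mainTheorem4 : (k n : ℕ) → 1 ≤ k → a (k ∸ 1) + 1 ≤ n → n ≤ a k → 2 ≤ n →
  (T : Tree) → IsAlmostPerfect T →
  (σ : Leaf T ↔ Fin n) →
  Σ ℕ (λ j → 1 ≤ j × j ≤ n ×
    MinMonoAtLeast T (λ x → toℕ (Inverse.to σ x) < j) k)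
mainTheorem4 zero _ () _ _ _ _ _ _
mainTheorem4 (suc k) n _ lower _ two T almost σ =
  level θ , ≤-trans (s≤s z≤n) (low< θ) , ≤-trans (≤high θ) (<⇒≤ (toℕ<n _)) ,
  monochromatic-cut-bound f θ
  where
  f : Leaf T → ℕ
  f x = toℕ (Inverse.to σ x)
  f-injective : Injective _≡_ _≡_ f
  f-injective same = Injection.injective (↔⇒↣ σ) (toℕ-injective same)
  n≤leaves : n ≤ leaves T
  n≤leaves = numbering-bound σ
  θ : Threshold T f (suc k)
  θ = hard-almost-perfect k T almost (≤-trans two n≤leaves)
        (≤-trans (subst (_≤ n) (+-comm (a k) 1) lower) n≤leaves) f f-injective
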